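{- Let $k\ge 3$ and $1\le j\le k-1$ be integers and let $s\ge 1$ be an integer. Up to isomorphism, the number of well-constructed $k$-uniform hypergraphs of $j$-size $s$ is at most $2^{ks^2}$.
   Context: A $k$-uniform hypergraph has edges that are $k$-element sets of vertices; a $j$-set is a set of $j$ vertices. The $j$-size of a $k$-uniform hypergraph $H$ is the number of $j$-sets contained in edges of $H$. A $k$-uniform hypergraph is well-constructed if it can be generated from an initial $j$-set via a search process, i.e.\ by successively adding edges such that each added edge contains at least one previously discovered $j$-set and also contains at least one previously undiscovered $j$-set (the discovered $j$-sets being the initial $j$-set together with all $j$-sets contained in edges added so far). -}

module Defs where

open import Data.Nat using (ℕ)
open import Data.Fin using (Fin)
open import Data.Fin.Subset using (Subset; ∣_∣; _⊆_) renaming (_∈_ to _∈ₛ_)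
open import Data.List using (List; []; _∷_; length)
open import Data.List.Membership.Propositional using (_∈_)
open import Data.List.Relation.Unary.All using (All)
open import Data.List.Relation.Unary.Unique.Propositional using (Unique)
open import Data.Product using (Σ; ∃; _×_; _,_)
open import Data.Sum using (_⊎_)
open import Data.Unit using (⊤)
open import Data.Vec using (tabulate; lookup)
open import Function.Bundles using (_⇔_; _↔_; Inverse)
open import Relation.Binary.PropositionalEquality using (_≡_)
open import Relation.Nullary using (¬_)

-- A k-uniform hypergraph: vertex set Fin n, edges a list of k-subsets
-- (list membership = edge set), with no isolated vertices
-- (vertex set = union of edges).
record Hypergraph (k : ℕ) : Set where
  field
    n        : ℕ
    edges    : List (Subset n)
    uniform  : All (λ e → ∣ e ∣ ≡ k) edges
    covering : (v : Fin n) → ∃ λ e → e ∈ edges × v ∈ₛ e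
open Hypergraph public

-- relabel a subset along a map g : Fin n' → Fin n (used with the inverse of a bijection)
relabel : {n n' : ℕ} → (Fin n' → Fin n) → Subset n → Subset n'
relabel g e = tabulate (λ i → lookup e (g i))

Iso : {k : ℕ} → Hypergraph k → Hypergraph k → Set
Iso H H' = Σ (Fin (n H) ↔ Fin (n H')) λ f →
  (e : Subset (n H)) → (e ∈ edges H) ⇔ (relabel (Inverse.from f) e ∈ edges H')

Covered : {n : ℕ} → ℕ → List (Subset n) → Subset n → Set
Covered j E A = ∣ A ∣ ≡ j × ∃ λ e → e ∈ E × A ⊆ e

JSize : {k : ℕ} → ℕ → Hypergraph k → ℕ → Set
JSize j H s = Σ (List (Subset (n H))) λ L →
  Unique L × length L ≡ s × ((A : Subset (n H)) → (A ∈ L) ⇔ Covered j (edges H) A)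

Discovered : {n : ℕ} → ℕ → Subset n → List (Subset n) → Subset n → Set
Discovered j A₀ prev B = ∣ B ∣ ≡ j × (B ≡ A₀ ⊎ ∃ λ e → e ∈ prev × B ⊆ e)

CanAdd : {n : ℕ} → ℕ → Subset n → List (Subset n) → Subset n → Set
CanAdd j A₀ prev e =
  (∃ λ B → B ⊆ e × Discovered j A₀ prev B) ×
  (∃ λ C → ∣ C ∣ ≡ j × C ⊆ e × ¬ Discovered j A₀ prev C)

-- a search process from A₀: edges added in the order of the list, prev = edges added so far
SearchSeq : {n : ℕ} → ℕ → Subset n → List (Subset n) → List (Subset n) → Set
SearchSeq j A₀ prev [] = ⊤
SearchSeq j A₀ prev (e ∷ es) = CanAdd j A₀ prev e × SearchSeq j A₀ (e ∷ prev) es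

WellConstructed : {k : ℕ} → ℕ → Hypergraph k → Set
WellConstructed j H = Σ (Subset (n H)) λ A₀ → Σ (List (Subset (n H))) λ es →
  ∣ A₀ ∣ ≡ j × SearchSeq j A₀ [] es × ((e : Subset (n H)) → (e ∈ es) ⇔ (e ∈ edges H))

module Submission where

open import Defs
open import Data.Nat using (ℕ; _≤_; _<_; _*_; _^_)
open import Data.List using (List; length)
open import Data.List.Relation.Unary.Any using (Any)
open import Data.Product using (Σ; _×_)

open import Data.Nat using (zero; suc; _+_; z≤n; s≤s)
open import Data.Nat.Properties
open import Data.Fin using (Fin)
open import Data.Fin.Properties using (injective⇒≤; all?)
open import Data.Fin.Subset using (Subset; ∣_∣; _∪_; ⋃; ⊥; ⊤; inside; outside)
  renaming (_∈_ to _∈ₛ_)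
open import Data.Fin.Subset.Properties
  using (∣⊥∣≡0; ∣⊤∣≡n; p⊆q⇒∣p∣≤∣q∣; p⊆p∪q; q⊆p∪q; _∈?_)
open import Data.List using ([]; _∷_; _++_; map; filter; cartesianProductWith; lookup)
open import Data.List.Properties using (length-++; length-map; filter-accept; filter-reject; ++-identityʳ)
open import Data.List.Membership.Propositional using (_∈_; find; lose)
open import Data.List.Membership.Propositional.Properties
  using (∈-lookup; ∈-++⁺ˡ; ∈-++⁺ʳ; ∈-map⁺; ∈-cartesianProductWith⁺)
open import Data.List.Membership.Setoid.Properties using (index-injective)
open import Data.List.Relation.Binary.Subset.Propositional using () renaming (_⊆_ to _⊆ₗ_)
open import Data.List.Relation.Binary.Permutation.Propositional.Properties using (∈-resp-↭; shift)
open import Data.List.Relation.Unary.Any using (here; there; any?; index)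
open import Data.List.Relation.Unary.All as All using (All; []; _∷_)
open import Data.List.Relation.Unary.All.Properties using (all-filter)
open import Data.List.Relation.Unary.Unique.Propositional using (Unique)
open import Data.List.Relation.Unary.AllPairs using ([]; _∷_)
open import Data.Product using (∃; _,_)
open import Data.Sum using (inj₁; inj₂)
open import Data.Empty using (⊥-elim)
open import Data.Vec using (Vec; []; _∷_; toList)
open import Data.Vec.Properties using (tabulate∘lookup)
open import Function.Bundles using (_⇔_; Equivalence; mk⇔)
open import Function.Construct.Identity using (↔-id)
open import Relation.Binary.PropositionalEquality
open import Relation.Nullary using (¬_; Dec; yes; no)

-- Proof idea (a coding argument).  Let H be well-constructed with j-size s = r + 1, generated
-- from A₀ by a search process adding the edges e₁, …, e_m.  Each added edge contains a j-set
-- that was undiscovered before, so the process discovers m + 1 distinct j-sets (A₀ and one new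
-- set per edge), all lying inside edges of H; hence m + 1 ≤ s, i.e. H has at most r edges.
-- Every vertex lies in an edge, so H has at most N = k·s vertices.  Therefore H is isomorphic
-- (via the identity of Fin (n H)) to the hypergraph decoded from a pair (m, c), where m ≤ N is
-- the number of vertices and c is the edge list padded with empty sets to a vector of r
-- subsets of Fin m; decoding keeps the k-sets of c.  There are at most (N + 1)·2^(N·r) such
-- codes, and (N + 1)·2^(N·r) ≤ 2^N·2^(N·r) = 2^(k·s·s).

module _ {A : Set} where

  unique-lookup-injective : ∀ {xs : List A} → Unique xs →
    ∀ {i j} → lookup xs i ≡ lookup xs j → i ≡ j
  unique-lookup-injective {_ ∷ _} (_ ∷ _) {Fin.zero} {Fin.zero} _ = refl
  unique-lookup-injective {_ ∷ _} (x∉ ∷ _) {Fin.zero} {Fin.suc j} eq =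
    ⊥-elim (All.lookup x∉ (∈-lookup j) eq)
  unique-lookup-injective {_ ∷ _} (x∉ ∷ _) {Fin.suc i} {Fin.zero} eq =
    ⊥-elim (All.lookup x∉ (∈-lookup i) (sym eq))
  unique-lookup-injective {_ ∷ _} (_ ∷ u) {Fin.suc i} {Fin.suc j} eq =
    cong Fin.suc (unique-lookup-injective u eq)

  -- A list without repetitions that is contained in ys is no longer than ys: sending each
  -- position of xs to the position of its element in ys is injective.
  unique-⊆-length : ∀ {xs ys : List A} → Unique xs → xs ⊆ₗ ys → length xs ≤ length ys
  unique-⊆-length {xs} {ys} u xs⊆ys = injective⇒≤ {f = position} λ {i} {j} eq →
    unique-lookup-injective u
      (index-injective (setoid A) (xs⊆ys (∈-lookup i)) (xs⊆ys (∈-lookup j)) eq)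
    where
    position : Fin (length xs) → Fin (length ys)
    position i = index (xs⊆ys (∈-lookup i))

  vectors : List A → (r : ℕ) → List (Vec A r)
  vectors xs zero = [] ∷ []
  vectors xs (suc r) = cartesianProductWith _∷_ xs (vectors xs r)

  length-vectors : ∀ (xs : List A) r → length (vectors xs r) ≡ length xs ^ r
  length-vectors xs zero = refl
  length-vectors xs (suc r) = trans (length-prepend xs) (cong (length xs *_) (length-vectors xs r))
    where
    length-prepend : ∀ ys → length (cartesianProductWith _∷_ ys (vectors xs r))
                          ≡ length ys * length (vectors xs r)
    length-prepend [] = refl
    length-prepend (y ∷ ys) =
      trans (length-++ (map (y ∷_) (vectors xs r)))
            (cong₂ _+_ (length-map (y ∷_) (vectors xs r)) (length-prepend ys))

  ∈-vectors : ∀ {xs : List A} → (∀ a → a ∈ xs) → ∀ {r} (v : Vec A r) → v ∈ vectors xs r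
  ∈-vectors every [] = here refl
  ∈-vectors every (a ∷ v) = ∈-cartesianProductWith⁺ _∷_ (every a) (∈-vectors every v)

  pad : A → (r : ℕ) → List A → Vec A r
  pad d zero _ = []
  pad d (suc r) [] = d ∷ pad d r []
  pad d (suc r) (x ∷ xs) = x ∷ pad d r xs

subsets : (m : ℕ) → List (Subset m)
subsets = vectors (outside ∷ inside ∷ [])

∈-subsets : ∀ {m} (e : Subset m) → e ∈ subsets m
∈-subsets = ∈-vectors λ { outside → here refl ; inside → there (here refl) }

-- 2 ^ n exceeds n; used to absorb the choice of the number of vertices.
n<2^n : ∀ n → n < 2 ^ n
n<2^n zero = s≤s z≤n
n<2^n (suc n) = ≤-trans (+-mono-≤ (m^n>0 2 n) (n<2^n n))
                        (≤-reflexive (cong (2 ^ n +_) (sym (+-identityʳ (2 ^ n)))))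

module Search {n : ℕ} (j : ℕ) (A₀ : Subset n) where

  discovered-mono : ∀ {E E' B} → E ⊆ₗ E' → Discovered j A₀ E B → Discovered j A₀ E' B
  discovered-mono _ (size , inj₁ B≡A₀) = size , inj₁ B≡A₀
  discovered-mono E⊆E' (size , inj₂ (e , e∈E , B⊆e)) = size , inj₂ (e , E⊆E' e∈E , B⊆e)

  -- Running the search steps es after the edges prev extends any list D of distinct
  -- discovered j-sets by one fresh j-set per step: the j-set that each step newly discovers.
  discover : ∀ {prev} es {D} → SearchSeq j A₀ prev es →
    Unique D → All (Discovered j A₀ prev) D →
    ∃ λ D' → Unique D' × All (Discovered j A₀ (es ++ prev)) D' × length D' ≡ length es + length D
  discover [] {D} _ u d = D , u , d , refl
  discover {prev} (e ∷ es) {D} ((_ , C , C-size , C⊆e , C-new) , steps) u d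
    with discover es steps (fresh ∷ u)
                  ((C-size , inj₂ (e , here refl , C⊆e)) ∷ All.map (discovered-mono there) d)
    where
    fresh : All (λ B → ¬ C ≡ B) D
    fresh = All.map (λ B-disc C≡B → C-new (subst (Discovered j A₀ prev) (sym C≡B) B-disc)) d
  ... | D' , u' , d' , len =
    D' , u' , All.map (discovered-mono (∈-resp-↭ (shift e es prev))) d' ,
    trans len (+-suc (length es) (length D))

  -- A nonempty search process from the j-set A₀ discovers one more distinct j-set than it has
  -- edges, and each of them lies inside one of its edges (A₀ lies inside the first edge).
  search-discovers : ∀ e es → ∣ A₀ ∣ ≡ j → SearchSeq j A₀ [] (e ∷ es) →
    ∃ λ D → Unique D × All (Covered j (e ∷ es)) D × length D ≡ suc (length (e ∷ es))
  search-discovers e es A₀-size steps@(((_ , A₀⊆e , (_ , inj₁ refl)) , _) , _)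
    with discover (e ∷ es) steps ([] ∷ []) ((A₀-size , inj₁ refl) ∷ [])
  ... | D , u , d , len =
    D , u , All.map covered (subst (λ E → All (Discovered j A₀ E) D) (++-identityʳ (e ∷ es)) d) ,
    trans len (+-comm (length (e ∷ es)) 1)
    where
    covered : ∀ {B} → Discovered j A₀ (e ∷ es) B → Covered j (e ∷ es) B
    covered (size , inj₁ refl) = size , e , here refl , A₀⊆e
    covered (size , inj₂ B-inside) = size , B-inside
  search-discovers e es _ (((_ , _ , (_ , inj₂ (_ , () , _))) , _) , _)

-- A search process generating (part of) a hypergraph of j-size r + 1 adds at most r edges:
-- the discovered j-sets are distinct and contained in edges, so there are at most r + 1 of them.
edge-bound : ∀ {k} j r (H : Hypergraph k) (A₀ : Subset (n H)) (es : List (Subset (n H))) →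
  ∣ A₀ ∣ ≡ j → SearchSeq j A₀ [] es → es ⊆ₗ edges H → JSize j H (suc r) → length es ≤ r
edge-bound j r H A₀ [] _ _ _ _ = z≤n
edge-bound j r H A₀ (e ∷ es) A₀-size steps es⊆H (L , _ , length-L , L-iff)
  with Search.search-discovers j A₀ e es A₀-size steps
... | D , u , covered , length-D = ≤-pred (subst₂ _≤_ length-D length-L
        (unique-⊆-length u λ B∈D → Equivalence.from (L-iff _) (in-H (All.lookup covered B∈D))))
  where
  in-H : ∀ {B} → Covered j (e ∷ es) B → Covered j (edges H) B
  in-H (size , f , f∈es , B⊆f) = size , f , es⊆H f∈es , B⊆f

∣p∪q∣≤∣p∣+∣q∣ : ∀ {m} (p q : Subset m) → ∣ p ∪ q ∣ ≤ ∣ p ∣ + ∣ q ∣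
∣p∪q∣≤∣p∣+∣q∣ [] [] = z≤n
∣p∪q∣≤∣p∣+∣q∣ (outside ∷ p) (outside ∷ q) = ∣p∪q∣≤∣p∣+∣q∣ p q
∣p∪q∣≤∣p∣+∣q∣ (outside ∷ p) (inside ∷ q) =
  ≤-trans (s≤s (∣p∪q∣≤∣p∣+∣q∣ p q)) (≤-reflexive (sym (+-suc ∣ p ∣ ∣ q ∣)))
∣p∪q∣≤∣p∣+∣q∣ (inside ∷ p) (outside ∷ q) = s≤s (∣p∪q∣≤∣p∣+∣q∣ p q)
∣p∪q∣≤∣p∣+∣q∣ (inside ∷ p) (inside ∷ q) =
  s≤s (≤-trans (m≤n⇒m≤1+n (∣p∪q∣≤∣p∣+∣q∣ p q)) (≤-reflexive (sym (+-suc ∣ p ∣ ∣ q ∣))))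

∣⋃∣≤ : ∀ {m} k (E : List (Subset m)) → All (λ e → ∣ e ∣ ≤ k) E → ∣ ⋃ E ∣ ≤ k * length E
∣⋃∣≤ {m} k [] [] = ≤-reflexive (trans (∣⊥∣≡0 m) (sym (*-zeroʳ k)))
∣⋃∣≤ k (e ∷ E) (e≤k ∷ E≤k) = begin
  ∣ e ∪ ⋃ E ∣           ≤⟨ ∣p∪q∣≤∣p∣+∣q∣ e (⋃ E) ⟩
  ∣ e ∣ + ∣ ⋃ E ∣       ≤⟨ +-mono-≤ e≤k (∣⋃∣≤ k E E≤k) ⟩
  k + k * length E      ≡⟨ *-suc k (length E) ⟨
  k * length (e ∷ E)    ∎
  where open ≤-Reasoning

∈-⋃ : ∀ {m} {v : Fin m} {e} (E : List (Subset m)) → e ∈ E → v ∈ₛ e → v ∈ₛ ⋃ E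
∈-⋃ (e ∷ E) (here refl) v∈e = p⊆p∪q (⋃ E) v∈e
∈-⋃ (e ∷ E) (there e∈E) v∈e = q⊆p∪q e (⋃ E) (∈-⋃ E e∈E v∈e)

vertex-bound : ∀ {m} k (E : List (Subset m)) → All (λ e → ∣ e ∣ ≤ k) E →
  ((v : Fin m) → ∃ λ e → e ∈ E × v ∈ₛ e) → m ≤ k * length E
vertex-bound {m} k E E≤k covering = begin
  m            ≡⟨ ∣⊤∣≡n m ⟨
  ∣ ⊤ {m} ∣    ≤⟨ p⊆q⇒∣p∣≤∣q∣ {p = ⊤} (λ {v} _ → let (e , e∈E , v∈e) = covering v in ∈-⋃ E e∈E v∈e) ⟩
  ∣ ⋃ E ∣      ≤⟨ ∣⋃∣≤ k E E≤k ⟩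
  k * length E ∎
  where open ≤-Reasoning

Covers : ∀ {m} → List (Subset m) → Set
Covers {m} E = (v : Fin m) → Any (v ∈ₛ_) E

covers? : ∀ {m} (E : List (Subset m)) → Dec (Covers E)
covers? E = all? λ v → any? (v ∈?_) E

-- The hypergraph on Fin m with edge list E when E covers all vertices, else the empty one.
hypergraphOn : ∀ {k} m (E : List (Subset m)) → All (λ e → ∣ e ∣ ≡ k) E → Dec (Covers E) →
  Hypergraph k
hypergraphOn m E uniform (yes covering) =
  record { n = m ; edges = E ; uniform = uniform ; covering = λ v → find (covering v) }
hypergraphOn m E _ (no _) = record { n = 0 ; edges = [] ; uniform = [] ; covering = λ () }

iso-hypergraphOn : ∀ {k} (H : Hypergraph k) (E : List (Subset (n H))) →
  (∀ e → (e ∈ edges H) ⇔ (e ∈ E)) → (uniform : All (λ e → ∣ e ∣ ≡ k) E) (d : Dec (Covers E)) →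
  Iso H (hypergraphOn (n H) E uniform d)
iso-hypergraphOn H E same uniform (yes _) = ↔-id _ , λ e → mk⇔
  (λ e∈H → subst (_∈ E) (sym (tabulate∘lookup e)) (Equivalence.to (same e) e∈H))
  (λ e∈E → Equivalence.from (same e) (subst (_∈ E) (tabulate∘lookup e) e∈E))
iso-hypergraphOn H E same uniform (no uncovered) = ⊥-elim (uncovered λ v →
  let (e , e∈H , v∈e) = covering H v in lose (Equivalence.to (same e) e∈H) v∈e)

kSets : ∀ {m} k → List (Subset m) → List (Subset m)
kSets k = filter (λ e → ∣ e ∣ ≟ k)

decode : ∀ k m {r} → Vec (Subset m) r → Hypergraph k
decode k m code = hypergraphOn m E (all-filter (λ e → ∣ e ∣ ≟ k) (toList code)) (covers? E)
  where E = kSets k (toList code)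

kSets-pad : ∀ {m} k → 0 < k → (r : ℕ) (es : List (Subset m)) → length es ≤ r →
  All (λ e → ∣ e ∣ ≡ k) es → kSets k (toList (pad ⊥ r es)) ≡ es
kSets-pad k k>0 zero [] _ _ = refl
kSets-pad {m} k k>0 (suc r) [] _ _ =
  trans (filter-reject (λ e → ∣ e ∣ ≟ k) {x = ⊥} {xs = toList (pad ⊥ r [])} (λ ∣⊥∣≡k → <⇒≢ k>0 (trans (sym (∣⊥∣≡0 m)) ∣⊥∣≡k)))
        (kSets-pad k k>0 r [] z≤n [])
kSets-pad k k>0 (suc r) (e ∷ es) (s≤s es≤r) (e-size ∷ es-size) =
  trans (filter-accept (λ e → ∣ e ∣ ≟ k) {xs = toList (pad ⊥ r es)} e-size)
        (cong (e ∷_) (kSets-pad k k>0 r es es≤r es-size))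

iso-decode : ∀ {k} r → 0 < k → (H : Hypergraph k) (es : List (Subset (n H))) →
  (∀ e → (e ∈ es) ⇔ (e ∈ edges H)) → length es ≤ r → Iso H (decode k (n H) (pad ⊥ r es))
iso-decode {k} r k>0 H es same es≤r =
  iso-hypergraphOn H (kSets k padded) edges-match (all-filter (λ e → ∣ e ∣ ≟ k) padded)
    (covers? (kSets k padded))
  where
  padded : List (Subset (n H))
  padded = toList (pad ⊥ r es)
  es-size : All (λ e → ∣ e ∣ ≡ k) es
  es-size = All.tabulate λ e∈es → All.lookup (uniform H) (Equivalence.to (same _) e∈es)
  edges-match : ∀ e → (e ∈ edges H) ⇔ (e ∈ kSets k padded)
  edges-match e rewrite kSets-pad k k>0 r es es≤r es-size =
    mk⇔ (Equivalence.from (same e)) (Equivalence.to (same e))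

decodings : ∀ k r → ℕ → List (Hypergraph k)
decodings k r zero = []
decodings k r (suc t) = map (decode k t) (vectors (subsets t) r) ++ decodings k r t

∈-decodings : ∀ k r {t m} (code : Vec (Subset m) r) → m < t → decode k m code ∈ decodings k r t
∈-decodings k r {suc t} {m} code m<t with m ≟ t
... | yes refl = ∈-++⁺ˡ (∈-map⁺ (decode k m) (∈-vectors ∈-subsets code))
... | no m≢t = ∈-++⁺ʳ _ (∈-decodings k r code (≤∧≢⇒< (≤-pred m<t) m≢t))

length-decodings : ∀ k r N t → t ≤ suc N → length (decodings k r t) ≤ t * 2 ^ (N * r)
length-decodings k r N zero _ = z≤n
length-decodings k r N (suc t) (s≤s t≤N) = begin
  length (map (decode k t) (vectors (subsets t) r) ++ decodings k r t)
    ≡⟨ length-++ (map (decode k t) (vectors (subsets t) r)) ⟩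
  length (map (decode k t) (vectors (subsets t) r)) + length (decodings k r t)
    ≡⟨ cong (_+ length (decodings k r t)) (trans (length-map (decode k t) (vectors (subsets t) r)) codes) ⟩
  2 ^ (t * r) + length (decodings k r t)
    ≤⟨ +-mono-≤ (^-monoʳ-≤ 2 (*-monoˡ-≤ r t≤N)) (length-decodings k r N t (m≤n⇒m≤1+n t≤N)) ⟩
  suc t * 2 ^ (N * r) ∎
  where
  open ≤-Reasoning
  codes : length (vectors (subsets t) r) ≡ 2 ^ (t * r)
  codes = trans (length-vectors (subsets t) r)
                (trans (cong (_^ r) (length-vectors _ t)) (^-*-assoc 2 t r))

proposition4p2 : (k j s : ℕ) → 3 ≤ k → 1 ≤ j → j < k → 1 ≤ s →
    Σ (List (Hypergraph k)) λ L → length L ≤ 2 ^ (k * s * s) ×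
    ((H : Hypergraph k) → WellConstructed j H → JSize j H s → Any (Iso H) L)
proposition4p2 k j (suc r) k≥3 _ _ _ = decodings k r (suc N) , length-bound , represented
  where
  N = k * suc r
  length-bound : length (decodings k r (suc N)) ≤ 2 ^ (N * suc r)
  length-bound = begin
    length (decodings k r (suc N)) ≤⟨ length-decodings k r N (suc N) ≤-refl ⟩
    suc N * 2 ^ (N * r)           ≤⟨ *-monoˡ-≤ (2 ^ (N * r)) (n<2^n N) ⟩
    2 ^ N * 2 ^ (N * r)           ≡⟨ ^-distribˡ-+-* 2 N (N * r) ⟨
    2 ^ (N + N * r)               ≡⟨ cong (2 ^_) (*-suc N r) ⟨
    2 ^ (N * suc r)               ∎
    where open ≤-Reasoning
  represented : (H : Hypergraph k) → WellConstructed j H → JSize j H (suc r) →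
    Any (Iso H) (decodings k r (suc N))
  represented H (A₀ , es , A₀-size , steps , same) jsize =
    lose (∈-decodings k r (pad ⊥ r es) (s≤s few-vertices))
         (iso-decode r (≤-trans (s≤s z≤n) k≥3) H es same few-edges)
    where
    es⊆H : es ⊆ₗ edges H
    es⊆H = Equivalence.to (same _)
    few-edges : length es ≤ r
    few-edges = edge-bound j r H A₀ es A₀-size steps es⊆H jsize
    es-cover : (v : Fin (n H)) → ∃ λ e → e ∈ es × v ∈ₛ e
    es-cover v = let (e , e∈H , v∈e) = covering H v in e , Equivalence.from (same e) e∈H , v∈e
    few-vertices : n H ≤ N
    few-vertices = ≤-trans
      (vertex-bound k es (All.tabulate λ e∈es → ≤-reflexive (All.lookup (uniform H) (es⊆H e∈es))) es-cover)
      (*-monoʳ-≤ k (m≤n⇒m≤1+n few-edges))
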